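{- No 4-terminal Hex position has combinatorial value equivalent to $\{\top\mid\bot\}$, where $\top$ is the outcome in which all four of Black's terminals are connected to each other and $\bot$ is the outcome in which no two of Black's terminals are connected to each other.
   Context: A 4-terminal Hex region is a finite set of hexagonal cells of the Hex grid (each cell has at most 6 neighbors) whose boundary consists of stones forming, in cyclic order, four connected groups of black stones (Black's terminals) alternating with four connected groups of white stones. A position in the region assigns black stones, white stones, or nothing to the cells of the region. When the region is completely filled, its outcome is the partition of Black's four terminals according to which of them are connected to each other by black chains within the region; outcomes are partially ordered so that $\bot$ (no two terminals connected) is least and $\top$ (all terminals connected) is greatest. The combinatorial value of a position is the game over this outcome poset defined recursively: a completely filled position has atomic value $[o]$ where $o$ is its outcome; otherwise its value is $\{L\mid R\}$ where $L$ is the set of values of positions obtained by Black (Left) placing a black stone on an empty cell, and $R$ the set of values obtained by White (Right) placing a white stone on an empty cell. Games over a poset $A$: $[a]$ atomic for $a\in A$, $\{L\mid R\}$ composite for non-empty sets $L,R$; $G\le H$ iff all $G^L\triangleright H$, all $H^R$ satisfy $G\triangleright H^R$, and if $G$ or $H$ is atomic then $G\triangleright H$; $G\triangleright H$ iff some $G^R\le H$, or some $H^L$ with $G\le H^L$, or $G=[a]$, $H=[b]$ atomic with $a\le b$. $G\equiv H$ iff $G\le H$ and $H\le G$. -}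

module Defs where

open import Level using (Level; _⊔_) renaming (suc to lsuc)
open import Data.Nat using (ℕ; zero; suc)
open import Data.Integer using (ℤ; +_; -[1+_]) renaming (_+_ to _+ℤ_)
open import Data.Fin using (Fin; zero; suc; _≟_)
open import Data.Product using (Σ; ∃; _×_; _,_)
open import Data.Sum using (_⊎_)
open import Data.Unit using (⊤)
open import Data.Empty using (⊥)
open import Data.Bool using (Bool; true; false; if_then_else_)
open import Data.List using (List; []; _∷_; _++_; [_]; take; map; length; allFin; filterᵇ)
open import Data.List.Membership.Propositional using (_∈_; _∉_)
open import Data.List.Relation.Unary.All using (All)
open import Data.List.Relation.Unary.Any using (Any)
open import Data.List.Relation.Unary.Linked using (Linked)
open import Data.List.Relation.Unary.Unique.Propositional using (Unique)
open import Relation.Binary.PropositionalEquality using (_≡_; _≢_)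
open import Relation.Nullary using (¬_; does)
open import Function.Definitions using (Injective)

module Games {a ℓ : Level} (A : Set a) (_≼_ : A → A → Set ℓ) where

  data Game : Set a where
    atom   : A → Game
    ⟪_∣_⟫ : List Game → List Game → Game

  lefts : Game → List Game
  lefts (atom _)      = []
  lefts ⟪ L ∣ _ ⟫ = L

  rights : Game → List Game
  rights (atom _)      = []
  rights ⟪ _ ∣ R ⟫ = R

  Atomic : Game → Set
  Atomic (atom _)      = ⊤
  Atomic ⟪ _ ∣ _ ⟫ = ⊥

  infix 4 _≤G_ _⊳_ _≡G_

  data _≤G_ : Game → Game → Set (a ⊔ ℓ)
  data _⊳_ : Game → Game → Set (a ⊔ ℓ)

  data _≤G_ where
    le : ∀ {G H} →
         All (λ GL → GL ⊳ H) (lefts G) →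
         All (λ HR → G ⊳ HR) (rights H) →
         (Atomic G ⊎ Atomic H → G ⊳ H) →
         G ≤G H

  data _⊳_ where
    ⊳-right : ∀ {G H} → Any (λ GR → GR ≤G H) (rights G) → G ⊳ H
    ⊳-left  : ∀ {G H} → Any (λ HL → G ≤G HL) (lefts H) → G ⊳ H
    ⊳-atom  : ∀ {x y} → x ≼ y → atom x ⊳ atom y

  _≡G_ : Game → Game → Set (a ⊔ ℓ)
  G ≡G H = (G ≤G H) × (H ≤G G)

Cell : Set
Cell = ℤ × ℤ

-- the six neighbour directions of a hexagon in axial coordinates
directions : List Cell
directions = (+ 1 , + 0) ∷ (-[1+ 0 ] , + 0) ∷ (+ 0 , + 1) ∷ (+ 0 , -[1+ 0 ])
           ∷ (+ 1 , -[1+ 0 ]) ∷ (-[1+ 0 ] , + 1) ∷ []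

_⊕_ : Cell → Cell → Cell
(x , y) ⊕ (u , v) = (x +ℤ u , y +ℤ v)

Adj : Cell → Cell → Set
Adj c d = ∃ λ δ → δ ∈ directions × d ≡ c ⊕ δ

CyclicChain : List Cell → Set
CyclicChain xs = Linked Adj (xs ++ take 1 xs)

boundaryOf : (Fin 4 → List Cell) → (Fin 4 → List Cell) → List Cell
boundaryOf b w = b zero ++ w zero ++ b (suc zero) ++ w (suc zero)
              ++ b (suc (suc zero)) ++ w (suc (suc zero))
              ++ b (suc (suc (suc zero))) ++ w (suc (suc (suc zero)))

record Region : Set where
  field
    size      : ℕ
    cell      : Fin size → Cell
    cell-inj  : Injective _≡_ _≡_ cell
    black     : Fin 4 → List Cell        -- Black's terminals (black boundary groups)
    white     : Fin 4 → List Cell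
  boundary : List Cell
  boundary = boundaryOf black white
  field
    black-nonempty : ∀ i → black i ≢ []
    white-nonempty : ∀ i → white i ≢ []
    boundary-unique   : Unique boundary
    boundary-disjoint : ∀ k → cell k ∉ boundary
    boundary-cycle    : CyclicChain boundary
    closed         : ∀ k c → Adj (cell k) c → (∃ λ k′ → cell k′ ≡ c) ⊎ c ∈ boundary
    boundary-touch : ∀ c → c ∈ boundary → ∃ λ k → Adj (cell k) c
    black-separate : ∀ i j → i ≢ j → ∀ c d → c ∈ black i → d ∈ black j → ¬ Adj c d
    white-separate : ∀ i j → i ≢ j → ∀ c d → c ∈ white i → d ∈ white j → ¬ Adj c d

data Colour : Set where
  blackStone whiteStone : Colour

data Content : Set where
  empty : Content
  stone : Colour → Content

module _ (R : Region) where
  open Region R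

  Position : Set
  Position = Fin size → Content

  isEmpty : Content → Bool
  isEmpty empty     = true
  isEmpty (stone _) = false

  emptyCells : Position → List (Fin size)
  emptyCells p = filterᵇ (λ k → isEmpty (p k)) (allFin size)

  place : Position → Fin size → Colour → Position
  place p k c j = if does (j ≟ k) then stone c else p j

  IsBlack : Position → Cell → Set
  IsBlack p c = (∃ λ i → c ∈ black i) ⊎ (∃ λ k → cell k ≡ c × p k ≡ stone blackStone)

  data BlackChain (p : Position) : Cell → Cell → Set where
    single : ∀ {c} → IsBlack p c → BlackChain p c c
    step   : ∀ {c d e} → IsBlack p c → Adj c d → BlackChain p d e → BlackChain p c e

  Outcome : Set₁
  Outcome = Fin 4 → Fin 4 → Set

  outcome : Position → Outcome
  outcome p i j = ∃ λ c → ∃ λ d → c ∈ black i × d ∈ black j × BlackChain p c d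

-- outcome poset: partitions ordered by refinement
_≼_ : (Fin 4 → Fin 4 → Set) → (Fin 4 → Fin 4 → Set) → Set
o ≼ o′ = ∀ i j → o i j → o′ i j

⊤ₒ : Fin 4 → Fin 4 → Set
⊤ₒ i j = ⊤

⊥ₒ : Fin 4 → Fin 4 → Set
⊥ₒ i j = i ≡ j

open Games (Fin 4 → Fin 4 → Set) _≼_ public

module _ (R : Region) where
  open Region R

  value′ : ℕ → Position R → Game
  value′ zero    p = atom (outcome R p)
  value′ (suc m) p =
    ⟪ map (λ k → value′ m (place R p k blackStone)) (emptyCells R p)
    ∣ map (λ k → value′ m (place R p k whiteStone)) (emptyCells R p) ⟫

  value : Position R → Game
  value p = value′ (length (emptyCells R p)) p

⊤∣⊥ : Game
⊤∣⊥ = ⟪ atom ⊤ₒ ∷ [] ∣ atom ⊥ₒ ∷ [] ⟫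

-- Strategy stealing.  If value p ≡ {⊤ ∣ ⊥}, then Black has a first move a after
-- which the value is ≥ [⊤], and White a first move b after which it is ≤ [⊥].
-- If a ≠ b, each player answers on the other's cell; both lines reach the same
-- position, with the same two facts and fewer empty cells.  If a = b, play on
-- two boards which differ only by the colour of the stone on a, copying each
-- move from one board to the other.  At the end all terminals are connected on
-- the first board and none on the second, so every terminal reaches a
-- neighbour of a by a black chain avoiding a.  The six neighbours of a hexagon
-- form three pairs of adjacent cells, so two of the four terminals reach the
-- same pair and are connected without a: a contradiction.
module Submission where

open import Defs
open import Relation.Nullary using (¬_)

open import Level using (Level)
open import Data.Nat using (ℕ; zero; suc; _≤_; _<_)
open import Data.Nat.Properties using (≤∧≢⇒<; ≤-refl; ≤-pred; <-≤-trans; n≮0)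
open import Data.Integer as ℤ using (ℤ; +_; _+_; _-_; -_)
open import Data.Integer.Properties using (+-identityʳ; +-inverseʳ; +-assoc)
open import Data.Fin using (Fin; zero; suc; _≟_; opposite)
open import Data.Fin.Properties using (all?; pigeonhole; <⇒≢)
open import Data.Product using (∃; ∃₂; _×_; _,_; proj₁; proj₂)
open import Data.Product.Properties using (≡-dec)
open import Data.Sum using (_⊎_; inj₁; inj₂)
open import Data.Unit using (tt)
open import Data.Empty using (⊥; ⊥-elim)
open import Data.Bool using (T; T?; if_then_else_)
open import Data.List using (_++_; lookup; length; filter; allFin)
open import Data.List.Membership.Propositional using (_∈_; find)
open import Data.List.Membership.Propositional.Properties
  using (∈-filter⁺; ∈-filter⁻; ∈-allFin; ∈-++⁺ˡ; ∈-++⁺ʳ; ∈-length)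
open import Data.List.Relation.Unary.All as All using (_∷_)
open import Data.List.Relation.Unary.Any using (index)
open import Data.List.Relation.Unary.Any.Properties using (lookup-index; map⁻)
import Data.List.Relation.Unary.All.Properties as Allₚ
open import Data.List.Relation.Binary.Sublist.Propositional using (_⊆_; ⊆-refl)
open import Data.List.Relation.Binary.Sublist.Propositional.Properties
  using (filter⁺; length-mono-≤; to-≋)
open import Data.List.Relation.Binary.Pointwise using (Pointwise-≡⇒≡)
open import Function using (_∘_)
open import Relation.Binary.PropositionalEquality
open import Relation.Nullary using (yes; no)
open import Relation.Nullary.Decidable using (from-yes; _→-dec_; _⊎-dec_; does)
open import Relation.Unary using (Pred; Decidable)
open import Relation.Binary.Definitions using (DecidableEquality)

module _ {a p q : Level} {A : Set a} {P : Pred A p} {Q : Pred A q}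
         (P? : Decidable P) (Q? : Decidable Q) where

  filter-length-< : (∀ {x} → Q x → P x) → ∀ {x xs} → x ∈ xs → P x → ¬ Q x →
                    length (filter Q? xs) < length (filter P? xs)
  filter-length-< Q⇒P {x} {xs} x∈xs px ¬qx =
    ≤∧≢⇒< (length-mono-≤ Q⊆P) lengths-differ
    where
    Q⊆P : filter Q? xs ⊆ filter P? xs
    Q⊆P = filter⁺ Q? P? {as = xs} (λ { refl → Q⇒P }) ⊆-refl
    lengths-differ : length (filter Q? xs) ≢ length (filter P? xs)
    lengths-differ eq = ¬qx (proj₂ (∈-filter⁻ Q? {xs = xs}
      (subst (x ∈_) (sym (Pointwise-≡⇒≡ (to-≋ eq Q⊆P))) (∈-filter⁺ P? x∈xs px))))

+-difference : ∀ {z} x d x′ d′ → z ≡ x + d → z ≡ x′ + d′ → x′ ≡ x + (d - d′)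
+-difference {z} x d x′ d′ z≡x+d z≡x′+d′ = begin
  x′             ≡⟨ sym (+-identityʳ x′) ⟩
  x′ + + 0       ≡⟨ cong (λ w → x′ + w) (sym (+-inverseʳ d′)) ⟩
  x′ + (d′ - d′) ≡⟨ sym (+-assoc x′ d′ (- d′)) ⟩
  x′ + d′ - d′   ≡⟨ cong (_- d′) (trans (sym z≡x′+d′) z≡x+d) ⟩
  x + d - d′     ≡⟨ +-assoc x d (- d′) ⟩
  x + (d - d′)   ∎
  where open ≡-Reasoning

_⊖_ : Cell → Cell → Cell
(x , y) ⊖ (u , v) = (x - u , y - v)

origin : Cell
origin = (+ 0 , + 0)

⊕-identityʳ : ∀ c → c ⊕ origin ≡ c
⊕-identityʳ (x , y) = cong₂ _,_ (+-identityʳ x) (+-identityʳ y)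

⊖-self : ∀ c → c ⊖ c ≡ origin
⊖-self (x , y) = cong₂ _,_ (+-inverseʳ x) (+-inverseʳ y)

neighbour-difference : ∀ {c} e δ e′ δ′ → c ≡ e ⊕ δ → c ≡ e′ ⊕ δ′ → e′ ≡ e ⊕ (δ ⊖ δ′)
neighbour-difference (x , y) (d , d₂) (x′ , y′) (d′ , d₂′) p q =
  cong₂ _,_ (+-difference x d x′ d′ (cong proj₁ p) (cong proj₁ q))
            (+-difference y d₂ y′ d₂′ (cong proj₂ p) (cong proj₂ q))

_≟ᶜ_ : DecidableEquality Cell
_≟ᶜ_ = ≡-dec ℤ._≟_ ℤ._≟_

open import Data.List.Membership.DecPropositional _≟ᶜ_ using (_∈?_)

direction : Fin 6 → Cell
direction = lookup directions

Adj-sym : ∀ {c d} → Adj c d → Adj d c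
Adj-sym {c} {d} (δ , δ∈ , d≡c⊕δ) =
  origin ⊖ δ , opposite∈ , neighbour-difference d origin c δ (sym (⊕-identityʳ d)) d≡c⊕δ
  where
  opposite∈ : origin ⊖ δ ∈ directions
  opposite∈ = subst (λ δ → origin ⊖ δ ∈ directions) (sym (lookup-index δ∈))
    (from-yes (all? λ i → origin ⊖ direction i ∈? directions) (index δ∈))

-- The six neighbours of a cell form three pairs of adjacent cells.
pair : Fin 6 → Fin 3
pair zero                                = zero
pair (suc zero)                          = suc zero
pair (suc (suc zero))                    = suc (suc zero)
pair (suc (suc (suc zero)))              = suc zero
pair (suc (suc (suc (suc zero))))        = zero
pair (suc (suc (suc (suc (suc zero)))))  = suc (suc zero)

pair-adjacent : ∀ i j → pair i ≡ pair j → i ≡ j ⊎ direction i ⊖ direction j ∈ directions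
pair-adjacent = from-yes (all? λ i → all? λ j →
  (pair i ≟ pair j) →-dec ((i ≟ j) ⊎-dec (direction i ⊖ direction j ∈? directions)))

slot : ∀ {e c} → Adj e c → Fin 6
slot (_ , δ∈ , _) = index δ∈

paired-neighbours : ∀ {c e e′} (p : Adj e c) (p′ : Adj e′ c) →
                    pair (slot {e} p) ≡ pair (slot {e′} p′) → e ≡ e′ ⊎ Adj e e′
paired-neighbours {c} {e} {e′} (δ , δ∈ , c≡) (δ′ , δ′∈ , c≡′) same
  with pair-adjacent (index δ∈) (index δ′∈) same
... | inj₁ same-slot = inj₁ (sym (begin
  e′                ≡⟨ neighbour-difference e δ′ e′ δ′ (subst (λ δ → c ≡ e ⊕ δ) δ≡δ′ c≡) c≡′ ⟩
  e ⊕ (δ′ ⊖ δ′)     ≡⟨ cong (e ⊕_) (⊖-self δ′) ⟩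
  e ⊕ origin        ≡⟨ ⊕-identityʳ e ⟩
  e                 ∎))
  where
  open ≡-Reasoning
  δ≡δ′ : δ ≡ δ′
  δ≡δ′ = trans (lookup-index δ∈) (trans (cong direction same-slot) (sym (lookup-index δ′∈)))
... | inj₂ difference∈ =
  inj₂ (δ ⊖ δ′ , subst₂ (λ u v → u ⊖ v ∈ directions)
                        (sym (lookup-index δ∈)) (sym (lookup-index δ′∈)) difference∈ ,
        neighbour-difference e δ e′ δ′ c≡ c≡′)

four-neighbours : ∀ {c} (e : Fin 4 → Cell) → (∀ i → Adj (e i) c) →
                  ∃₂ λ i j → i ≢ j × (e i ≡ e j ⊎ Adj (e i) (e j))
four-neighbours e adj
  with i , j , i<j , same ← pigeonhole ≤-refl (λ i → pair (slot {e i} (adj i)))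
  = i , j , <⇒≢ i<j , paired-neighbours (adj i) (adj j) same

module _ {R : Region} {p : Position R} where

  chain-link : ∀ {c e e′ d} → BlackChain R p c e → Adj e e′ → BlackChain R p e′ d →
               BlackChain R p c d
  chain-link (single b)        adj rest′ = step b adj rest′
  chain-link (step b adj rest) adj′ rest′ = step b adj (chain-link rest adj′ rest′)

  chain-trans : ∀ {c e d} → BlackChain R p c e → BlackChain R p e d → BlackChain R p c d
  chain-trans (single _)        rest′ = rest′
  chain-trans (step b adj rest) rest′ = step b adj (chain-trans rest rest′)

  chain-sym : ∀ {c d} → BlackChain R p c d → BlackChain R p d c
  chain-sym (single b)        = single b
  chain-sym (step b adj rest) = chain-link (chain-sym rest) (Adj-sym adj) (single b)

chain-map : ∀ {R} {p q : Position R} → (∀ {x} → IsBlack R p x → IsBlack R q x) →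
            ∀ {c d} → BlackChain R p c d → BlackChain R q c d
chain-map f (single b)        = single (f b)
chain-map f (step b adj rest) = step (f b) adj (chain-map f rest)

⊤ₒ⋠⊥ₒ : ¬ (⊤ₒ ≼ ⊥ₒ)
⊤ₒ⋠⊥ₒ ⊤≼⊥ with () ← ⊤≼⊥ zero (suc zero) tt

opposite-≢ : ∀ (i : Fin 4) → opposite i ≢ i
opposite-≢ zero                   ()
opposite-≢ (suc zero)             ()
opposite-≢ (suc (suc zero))       ()
opposite-≢ (suc (suc (suc zero))) ()

atom≤atom⁻ : ∀ {x y} → atom x ≤G atom y → x ≼ y
atom≤atom⁻ (le _ _ atomic) with atomic (inj₁ tt)
... | ⊳-atom x≼y = x≼y
... | ⊳-right ()
... | ⊳-left ()

atom⊳atom⁻ : ∀ {x y} → atom x ⊳ atom y → x ≼ y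
atom⊳atom⁻ (⊳-atom x≼y) = x≼y
atom⊳atom⁻ (⊳-right ())
atom⊳atom⁻ (⊳-left ())

≤atom⇒⊳ : ∀ {G y} → G ≤G atom y → G ⊳ atom y
≤atom⇒⊳ (le _ _ atomic) = atomic (inj₂ tt)

[⊤] [⊥] : Game
[⊤] = atom ⊤ₒ
[⊥] = atom ⊥ₒ

≡G⊤∣⊥⇒ : ∀ {G} → G ≡G ⊤∣⊥ → [⊤] ⊳ G × G ⊳ [⊥]
≡G⊤∣⊥⇒ (le _ (G⊳⊥ ∷ _) _ , le (⊤⊳G ∷ _) _ _) = ⊤⊳G , G⊳⊥

module _ (R : Region) where
  open Region R

  place-same : ∀ p k c → place R p k c k ≡ stone c
  place-same p k c with k ≟ k
  ... | yes _   = refl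
  ... | no k≢k = ⊥-elim (k≢k refl)

  place-other : ∀ p {k} c {j} → j ≢ k → place R p k c j ≡ p j
  place-other p {k} c {j} j≢k with j ≟ k
  ... | yes j≡k = ⊥-elim (j≢k j≡k)
  ... | no _    = refl

  place-cong : ∀ p q k c j → p j ≡ q j → place R p k c j ≡ place R q k c j
  place-cong _ _ k c j = cong (if does (j ≟ k) then stone c else_)

  place-comm : ∀ p {k l} c d → k ≢ l →
               place R (place R p k c) l d ≗ place R (place R p l d) k c
  place-comm p {k} {l} c d k≢l j with j ≟ k | j ≟ l
  ... | yes refl | yes refl = ⊥-elim (k≢l refl)
  ... | yes _    | no _     = refl
  ... | no _     | yes _    = refl
  ... | no _     | no _     = refl

  placed-occupied : ∀ p k c → place R p k c k ≢ empty
  placed-occupied p k c eq with () ← trans (sym (place-same p k c)) eq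

  isEmpty-true : ∀ {x} → T (isEmpty R x) → x ≡ empty
  isEmpty-true {empty} _ = refl

  empty-isEmpty : ∀ {x} → x ≡ empty → T (isEmpty R x)
  empty-isEmpty refl = tt

  ∈-emptyCells⁺ : ∀ {p k} → p k ≡ empty → k ∈ emptyCells R p
  ∈-emptyCells⁺ {p} {k} = ∈-filter⁺ (λ j → T? (isEmpty R (p j))) (∈-allFin k) ∘ empty-isEmpty

  ∈-emptyCells⁻ : ∀ {p k} → k ∈ emptyCells R p → p k ≡ empty
  ∈-emptyCells⁻ {p} =
    isEmpty-true ∘ proj₂ ∘ ∈-filter⁻ (λ j → T? (isEmpty R (p j))) {xs = allFin size}

  emptyCells-place-< : ∀ {p k} c → k ∈ emptyCells R p →
                       length (emptyCells R (place R p k c)) < length (emptyCells R p)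
  emptyCells-place-< {p} {k} c k∈ =
    filter-length-< (λ j → T? (isEmpty R (p j))) (λ j → T? (isEmpty R (place R p k c j)))
      still-empty (∈-allFin k) (empty-isEmpty (∈-emptyCells⁻ k∈))
      (placed-occupied p k c ∘ isEmpty-true)
    where
    still-empty : ∀ {j} → T (isEmpty R (place R p k c j)) → T (isEmpty R (p j))
    still-empty {j} t with j ≟ k
    ... | no _ = t

  skip-pair : ∀ i {c rest} → c ∈ rest → c ∈ black i ++ white i ++ rest
  skip-pair i = ∈-++⁺ʳ (black i) ∘ ∈-++⁺ʳ (white i)

  black⊆boundary : ∀ i {c} → c ∈ black i → c ∈ boundary
  black⊆boundary zero                   = ∈-++⁺ˡ
  black⊆boundary (suc zero)             = skip-pair zero ∘ ∈-++⁺ˡ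
  black⊆boundary (suc (suc zero))       = skip-pair zero ∘ skip-pair (suc zero) ∘ ∈-++⁺ˡ
  black⊆boundary (suc (suc (suc zero))) =
    skip-pair zero ∘ skip-pair (suc zero) ∘ skip-pair (suc (suc zero)) ∘ ∈-++⁺ˡ

  TerminalChain : Position R → Fin 4 → Cell → Set
  TerminalChain p i e = ∃ λ c → c ∈ black i × BlackChain R p c e

  outcome-mono : ∀ {p q} → p ≗ q → outcome R p ≼ outcome R q
  outcome-mono {p} {q} p≗q i j (c , d , c∈ , d∈ , chain) = c , d , c∈ , d∈ , chain-map isBlack chain
    where
    isBlack : ∀ {x} → IsBlack R p x → IsBlack R q x
    isBlack (inj₁ terminal)           = inj₁ terminal
    isBlack (inj₂ (k , refl , black)) = inj₂ (k , refl , trans (sym (p≗q k)) black)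

  module _ {F₁ F₂ : Position R} {a : Fin size} (agree : ∀ k → k ≢ a → F₁ k ≡ F₂ k) where

    isBlack-off : ∀ {x} → x ≢ cell a → IsBlack R F₁ x → IsBlack R F₂ x
    isBlack-off _ (inj₁ terminal) = inj₁ terminal
    isBlack-off x≢a (inj₂ (k , refl , black)) with k ≟ a
    ... | yes refl = ⊥-elim (x≢a refl)
    ... | no k≢a   = inj₂ (k , refl , trans (sym (agree k k≢a)) black)

    chain-avoiding-or-reaching :
      ∀ {c d} → BlackChain R F₁ c d →
      BlackChain R F₂ c d ⊎ c ≡ cell a ⊎ ∃ λ e → BlackChain R F₂ c e × Adj e (cell a)
    chain-avoiding-or-reaching (single {c} b) with c ≟ᶜ cell a
    ... | yes c≡a = inj₂ (inj₁ c≡a)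
    ... | no c≢a  = inj₁ (single (isBlack-off c≢a b))
    chain-avoiding-or-reaching (step {c} b adj rest) with c ≟ᶜ cell a
    ... | yes c≡a = inj₂ (inj₁ c≡a)
    ... | no c≢a with chain-avoiding-or-reaching rest
    ...   | inj₁ rest′       = inj₁ (step (isBlack-off c≢a b) adj rest′)
    ...   | inj₂ (inj₁ refl) = inj₂ (inj₂ (c , single (isBlack-off c≢a b) , adj))
    ...   | inj₂ (inj₂ (e , rest′ , near)) =
      inj₂ (inj₂ (e , step (isBlack-off c≢a b) adj rest′ , near))

    module _ (top : ⊤ₒ ≼ outcome R F₁) (bottom : outcome R F₂ ≼ ⊥ₒ) where

      terminal-reaches-neighbour : ∀ i → ∃ λ e → Adj e (cell a) × TerminalChain F₂ i e
      terminal-reaches-neighbour i with top i (opposite i) tt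
      ... | c , d , c∈ , d∈ , chain with chain-avoiding-or-reaching chain
      ...   | inj₁ chain′ =
        ⊥-elim (opposite-≢ i (sym (bottom i (opposite i) (c , d , c∈ , d∈ , chain′))))
      ...   | inj₂ (inj₁ refl) = ⊥-elim (boundary-disjoint a (black⊆boundary i c∈))
      ...   | inj₂ (inj₂ (e , chain′ , near)) = e , near , c , c∈ , chain′

      connect : ∀ {i j e e′} → TerminalChain F₂ i e → TerminalChain F₂ j e′ →
                e ≡ e′ ⊎ Adj e e′ → outcome R F₂ i j
      connect (c , c∈ , chain) (d , d∈ , chain′) (inj₁ refl) =
        c , d , c∈ , d∈ , chain-trans chain (chain-sym chain′)
      connect (c , c∈ , chain) (d , d∈ , chain′) (inj₂ adj) =
        c , d , c∈ , d∈ , chain-link chain adj (chain-sym chain′)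

      ⊤-to-⊥-needs-two-cells : ⊥
      ⊤-to-⊥-needs-two-cells =
        let i , j , i≢j , near = four-neighbours (proj₁ ∘ terminal-reaches-neighbour)
                                                 (proj₁ ∘ proj₂ ∘ terminal-reaches-neighbour)
        in  i≢j (bottom i j (connect (proj₂ (proj₂ (terminal-reaches-neighbour i)))
                                     (proj₂ (proj₂ (terminal-reaches-neighbour j))) near))

  module _ {x : Fin 4 → Fin 4 → Set} {m : ℕ} {p : Position R} where

    atom⊳value-suc⁻ : atom x ⊳ value′ R (suc m) p →
                      ∃ λ k → k ∈ emptyCells R p × atom x ≤G value′ R m (place R p k blackStone)
    atom⊳value-suc⁻ (⊳-left move) = find (map⁻ move)
    atom⊳value-suc⁻ (⊳-right ())

    value-suc⊳atom⁻ : value′ R (suc m) p ⊳ atom x →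
                      ∃ λ k → k ∈ emptyCells R p × value′ R m (place R p k whiteStone) ≤G atom x
    value-suc⊳atom⁻ (⊳-right move) = find (map⁻ move)
    value-suc⊳atom⁻ (⊳-left ())

    atom≤value-suc⁻ : atom x ≤G value′ R (suc m) p →
                      ∀ {k} → k ∈ emptyCells R p → atom x ⊳ value′ R m (place R p k whiteStone)
    atom≤value-suc⁻ (le _ replies _) = All.lookup (Allₚ.map⁻ replies)

    value-suc≤atom⁻ : value′ R (suc m) p ≤G atom x →
                      ∀ {k} → k ∈ emptyCells R p → value′ R m (place R p k blackStone) ⊳ atom x
    value-suc≤atom⁻ (le replies _ _) = All.lookup (Allₚ.map⁻ replies)

  record Twins (Q₁ Q₂ : Position R) (a : Fin size) : Set where
    field
      agree     : ∀ k → k ≢ a → Q₁ k ≡ Q₂ k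
      occupied₁ : Q₁ a ≢ empty
      occupied₂ : Q₂ a ≢ empty
  open Twins

  twins-sym : ∀ {Q₁ Q₂ a} → Twins Q₁ Q₂ a → Twins Q₂ Q₁ a
  twins-sym t = record
    { agree     = λ k k≢a → sym (agree t k k≢a)
    ; occupied₁ = occupied₂ t
    ; occupied₂ = occupied₁ t
    }

  twins-empty : ∀ {Q₁ Q₂ a k} → Twins Q₁ Q₂ a → k ∈ emptyCells R Q₁ →
                k ≢ a × k ∈ emptyCells R Q₂
  twins-empty {Q₁} {a = a} {k} t k∈ =
    k≢a , ∈-emptyCells⁺ (trans (sym (agree t k k≢a)) Q₁k≡empty)
    where
    Q₁k≡empty : Q₁ k ≡ empty
    Q₁k≡empty = ∈-emptyCells⁻ k∈
    k≢a : k ≢ a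
    k≢a refl = occupied₁ t Q₁k≡empty

  twins-place : ∀ {Q₁ Q₂ a k} → Twins Q₁ Q₂ a → k ≢ a → ∀ c →
                Twins (place R Q₁ k c) (place R Q₂ k c) a
  twins-place {Q₁} {Q₂} {a} {k} t k≢a c = record
    { agree     = λ j j≢a → place-cong Q₁ Q₂ k c j (agree t j j≢a)
    ; occupied₁ = occupied₁ t ∘ trans (sym (place-other Q₁ c a≢k))
    ; occupied₂ = occupied₂ t ∘ trans (sym (place-other Q₂ c a≢k))
    }
    where
    a≢k : a ≢ k
    a≢k = k≢a ∘ sym

  mutual
    twin-⊤≤-⊳⊥-impossible : ∀ n {Q₁ Q₂ a} → Twins Q₁ Q₂ a →
                             [⊤] ≤G value′ R n Q₁ → value′ R n Q₂ ⊳ [⊥] → ⊥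
    twin-⊤≤-⊳⊥-impossible zero t top bottom =
      ⊤-to-⊥-needs-two-cells (agree t) (atom≤atom⁻ top) (atom⊳atom⁻ bottom)
    twin-⊤≤-⊳⊥-impossible (suc m) t top bottom =
      let b , b∈₂ , bottom′ = value-suc⊳atom⁻ bottom
          b≢a , b∈₁ = twins-empty (twins-sym t) b∈₂
      in  twin-⊤⊳-≤⊥-impossible m (twins-place t b≢a whiteStone) (atom≤value-suc⁻ top b∈₁) bottom′

    twin-⊤⊳-≤⊥-impossible : ∀ n {Q₁ Q₂ a} → Twins Q₁ Q₂ a →
                             [⊤] ⊳ value′ R n Q₁ → value′ R n Q₂ ≤G [⊥] → ⊥
    twin-⊤⊳-≤⊥-impossible zero t top bottom =
      ⊤-to-⊥-needs-two-cells (agree t) (atom⊳atom⁻ top) (atom≤atom⁻ bottom)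
    twin-⊤⊳-≤⊥-impossible (suc m) t top bottom =
      let b , b∈₁ , top′ = atom⊳value-suc⁻ top
          b≢a , b∈₂ = twins-empty t b∈₁
      in  twin-⊤≤-⊳⊥-impossible m (twins-place t b≢a blackStone) top′ (value-suc≤atom⁻ bottom b∈₂)

  first-twins : ∀ {Q₁ Q₂} → Q₁ ≗ Q₂ → ∀ a →
                Twins (place R Q₁ a blackStone) (place R Q₂ a whiteStone) a
  first-twins {Q₁} {Q₂} Q₁≗Q₂ a = record
    { agree     = λ k k≢a → begin
        place R Q₁ a blackStone k ≡⟨ place-other Q₁ blackStone k≢a ⟩
        Q₁ k                      ≡⟨ Q₁≗Q₂ k ⟩
        Q₂ k                      ≡⟨ place-other Q₂ whiteStone k≢a ⟨
        place R Q₂ a whiteStone k ∎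
    ; occupied₁ = placed-occupied Q₁ a blackStone
    ; occupied₂ = placed-occupied Q₂ a whiteStone
    }
    where open ≡-Reasoning

  -- Only a bound on the number of empty cells is kept as invariant; it is what
  -- rules out running out of fuel while a cell is still empty (case answer zero).
  ⊤⊳value⊳⊥-impossible : ∀ n {Q₁ Q₂} → Q₁ ≗ Q₂ → length (emptyCells R Q₁) ≤ n →
                          [⊤] ⊳ value′ R n Q₁ → value′ R n Q₂ ⊳ [⊥] → ⊥
  ⊤⊳value⊳⊥-impossible zero Q₁≗Q₂ _ top bottom =
    ⊤ₒ⋠⊥ₒ λ i j → atom⊳atom⁻ bottom i j ∘ outcome-mono Q₁≗Q₂ i j ∘ atom⊳atom⁻ top i j
  ⊤⊳value⊳⊥-impossible (suc m) {Q₁} {Q₂} Q₁≗Q₂ fuel top bottom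
    with a , a∈ , top′ ← atom⊳value-suc⁻ top
       | b , b∈ , bottom′ ← value-suc⊳atom⁻ bottom
       | a ≟ b
  ... | yes refl = twin-⊤≤-⊳⊥-impossible m (first-twins Q₁≗Q₂ a) top′ (≤atom⇒⊳ bottom′)
  ... | no a≢b   =
    answer m (≤-pred (<-≤-trans (emptyCells-place-< blackStone a∈) fuel)) top′ bottom′
    where
    Q₁′ Q₂′ : Position R
    Q₁′ = place R Q₁ a blackStone
    Q₂′ = place R Q₂ b whiteStone

    b∈Q₁′ : b ∈ emptyCells R Q₁′
    b∈Q₁′ = ∈-emptyCells⁺ (trans (place-other Q₁ blackStone (a≢b ∘ sym))
                                 (trans (Q₁≗Q₂ b) (∈-emptyCells⁻ b∈)))

    a∈Q₂′ : a ∈ emptyCells R Q₂′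
    a∈Q₂′ = ∈-emptyCells⁺ (trans (place-other Q₂ whiteStone a≢b)
                                 (trans (sym (Q₁≗Q₂ a)) (∈-emptyCells⁻ a∈)))

    swapped : place R Q₁′ b whiteStone ≗ place R Q₂′ a blackStone
    swapped j = trans (place-comm Q₁ blackStone whiteStone a≢b j)
                      (place-cong (place R Q₁ b whiteStone) Q₂′ a blackStone j
                        (place-cong Q₁ Q₂ b whiteStone j (Q₁≗Q₂ j)))

    answer : ∀ m → length (emptyCells R Q₁′) ≤ m →
             [⊤] ≤G value′ R m Q₁′ → value′ R m Q₂′ ≤G [⊥] → ⊥
    answer zero    fuel′ _ _ = n≮0 (<-≤-trans (∈-length b∈Q₁′) fuel′)
    answer (suc m) fuel′ top″ bottom″ =
      ⊤⊳value⊳⊥-impossible m swapped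
        (≤-pred (<-≤-trans (emptyCells-place-< whiteStone b∈Q₁′) fuel′))
        (atom≤value-suc⁻ top″ b∈Q₁′) (value-suc≤atom⁻ bottom″ a∈Q₂′)

proposition11p1 : (R : Region) (p : Position R) → ¬ (value R p ≡G ⊤∣⊥)
proposition11p1 R p value≡⊤∣⊥ =
  let ⊤⊳value , value⊳⊥ = ≡G⊤∣⊥⇒ value≡⊤∣⊥
  in  ⊤⊳value⊳⊥-impossible R (length (emptyCells R p)) (λ _ → refl) ≤-refl ⊤⊳value value⊳⊥
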